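{- Let $1\le j\le k-1$ be integers, $V$ a finite set, $\ell>r,b\ge 0$ integers, and $\sigma=(\sigma_j,\sigma_k)$ a pair of total orders on $V^{(j)}$ and $V^{(k)}$. For any $T=(\mathcal{J}_0,\mathcal{E}_1,\mathcal{E}_2)\in\mathcal{T}_{\ell,r,b}$, its blueprint $\pi_\sigma(T)=(R,B)$ satisfies $f(R)=f(B)=|\mathcal{J}_0|-1=\ell-1$, $g(R)=|\mathcal{E}_1|=r$ and $g(B)=|\mathcal{E}_2|=b$. In other words, $\pi_\sigma(\mathcal{T}_{\ell,r,b})\subseteq \mathcal{M}_{\ell,r}\times\mathcal{M}_{\ell,b}$.
   Context: For a set $V$, $V^{(i)}$ denotes the set of $i$-subsets. For $E\subseteq V^{(k)}$ and $\mathcal{J}\subseteq V^{(j)}$, $\mathcal{J}$ is traversable in $(V,E)$ if $|\mathcal{J}|=1$ or for every two distinct $J,J'\in\mathcal{J}$ there are edges $e_1,\dots,e_m\in E$ with $J\subseteq e_1$, $J'\subseteq e_m$ and, for each $1\le i<m$, some $J_i\in\mathcal{J}$ with $J_i\subseteq e_i\cap e_{i+1}$. A triple $(\mathcal{J}_0,\mathcal{E}_1,\mathcal{E}_2)$ ($\mathcal{J}_0\subseteq V^{(j)}$; $\mathcal{E}_1,\mathcal{E}_2\subseteq V^{(k)}$, called red and blue edges) is traversable if $\mathcal{J}_0$ is traversable in both $(V,\mathcal{E}_1)$ and $(V,\mathcal{E}_2)$; it is edge-minimal traversable if moreover removing any single red or blue edge destroys traversability. $\mathcal{T}_{\ell,r,b}$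 is the set of edge-minimal traversable triples with $|\mathcal{J}_0|=\ell$, $|\mathcal{E}_1|=r$, $|\mathcal{E}_2|=b$. Blueprint: given $T=(\mathcal{J}_0,\mathcal{E}_1,\mathcal{E}_2)\in\mathcal{T}_{\ell,r,b}$ and $\sigma$, run a breadth-first exploration of $\mathcal{J}_0$ with red edges: let $J_{(1)}$ be the $\sigma_j$-minimal element of $\mathcal{J}_0$; colour it white and make it active. When a $j$-set $J$ is active, consider, in $\sigma_k$-order, all edges of $\mathcal{E}_1$ containing $J$ not previously considered; for each such edge in turn colour white, in $\sigma_j$-order, all $j$-sets of $\mathcal{J}_0$ contained in it that are not yet white. Then the next $j$-set (in order of being coloured white) becomes active. The order in which sets were coloured white is $\tau_\sigma(T)=(J_{(1)},\dots,J_{(\ell)})$. Marking: initially $J_{(1)}$ is marked; for $i=1,\dots,\ell$ (with $J_{(i)}$ active) reveal, in $\sigma_k$-order, all edges of $\mathcal{E}_2$ that contain $J_{(i)}$ and none of $J_{(i+1)},\dots,J_{(\ell)}$; each revealed blue edge marks all still-unmarked $j$-sets of $\mathcal{J}_0$ it contains. An edge performs $z$-duty if, when considered/revealed, it colours (resp. marks) exactly $z$ $j$-sets. $r_{i,z}$ is the number of red $z$-duty edges considered while $J_{(i)}$ is active, and $b_{i,z}$ the number of blue $z$-duty edges revealed while $J_{(i)}$ is active, for $1\le i\le\ell$, $0\le z\le\binom{k}{j}$. The blueprint is $\pi_\sigma(T)=(R,B)$ with $R=(r_{i,z})$, $B=(b_{i,z})$. For an $a\times(\binom{k}{j}+1)$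 matrix $M=(m_{i,z})$ ($1\le i\le a$, $0\le z\le\binom{k}{j}$) with non-negative integer entries, $f(M)=\sum_{i,z} z\,m_{i,z}$ and $g(M)=\sum_{i,z} m_{i,z}$; $\mathcal{M}_{a,m}$ is the set of such matrices with $f(M)=a-1$ and $g(M)=m$. -}

module Defs where

open import Data.Bool using (Bool; true; false; _∧_; not; if_then_else_)
open import Data.Nat using (ℕ; zero; suc; _+_; _*_; _∸_; _≤ᵇ_; _≡ᵇ_)
open import Data.Fin using (Fin; toℕ)
open import Data.Fin.Subset using (Subset; _⊆_; ∣_∣)
open import Data.Fin.Subset.Properties using (_⊆?_)
open import Data.Bool.Properties using () renaming (_≟_ to _≟B_)
open import Data.Vec.Properties using (≡-dec)
open import Data.List using (List; []; _∷_; _++_; length; filter; filterᵇ)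
open import Data.Bool.ListAction using (any; all)
open import Data.List.Membership.Propositional using (_∈_)
open import Data.List.Relation.Unary.All using (All)
open import Data.List.Relation.Unary.Unique.Propositional using (Unique)
open import Data.Maybe using (Maybe; just; nothing)
open import Data.Product using (_×_; _,_; Σ; ∃; proj₁; proj₂)
open import Data.Sum using (_⊎_)
open import Relation.Nullary using (¬_; ¬?; does)
open import Relation.Binary.PropositionalEquality using (_≡_; _≢_)

-- Ground set V = Fin n; subsets of V are `Subset n`; i-subsets are those
-- of cardinality i.  Families of subsets are duplicate-free lists.

module _ {n : ℕ} where

  _≟S_ : (x y : Subset n) → Relation.Nullary.Dec (x ≡ y)
  _≟S_ = ≡-dec _≟B_

  IsFamily : ℕ → List (Subset n) → Set
  IsFamily i 𝒳 = Unique 𝒳 × All (λ X → ∣ X ∣ ≡ i) 𝒳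

  -- Chain 𝒥 E J' e : a sequence of edges e = e₁, e₂, …, e_m of E (e₁ ∈ E
  -- assumed separately) with J' ⊆ e_m and consecutive edges sharing a
  -- member of 𝒥.
  data Chain (𝒥 E : List (Subset n)) (J' : Subset n) : Subset n → Set where
    end  : ∀ {e} → J' ⊆ e → Chain 𝒥 E J' e
    step : ∀ {e e' Ji} → e' ∈ E → Ji ∈ 𝒥 → Ji ⊆ e → Ji ⊆ e' →
           Chain 𝒥 E J' e' → Chain 𝒥 E J' e

  Traversable : List (Subset n) → List (Subset n) → Set
  Traversable 𝒥 E =
    length 𝒥 ≡ 1 ⊎
    (∀ J J' → J ∈ 𝒥 → J' ∈ 𝒥 → J ≢ J' →
       Σ (Subset n) λ e → e ∈ E × J ⊆ e × Chain 𝒥 E J' e)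

  TraversableTriple : List (Subset n) → List (Subset n) → List (Subset n) → Set
  TraversableTriple 𝒥₀ E₁ E₂ = Traversable 𝒥₀ E₁ × Traversable 𝒥₀ E₂

  remove : Subset n → List (Subset n) → List (Subset n)
  remove e = filter (λ x → ¬? (x ≟S e))

  EdgeMinimal : List (Subset n) → List (Subset n) → List (Subset n) → Set
  EdgeMinimal 𝒥₀ E₁ E₂ =
    TraversableTriple 𝒥₀ E₁ E₂ ×
    (∀ e → e ∈ E₁ → ¬ TraversableTriple 𝒥₀ (remove e E₁) E₂) ×
    (∀ e → e ∈ E₂ → ¬ TraversableTriple 𝒥₀ E₁ (remove e E₂))

  InT : (j k ℓ r b : ℕ) → List (Subset n) → List (Subset n) → List (Subset n) → Set
  InT j k ℓ r b 𝒥₀ E₁ E₂ =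
    IsFamily j 𝒥₀ × IsFamily k E₁ × IsFamily k E₂ ×
    length 𝒥₀ ≡ ℓ × length E₁ ≡ r × length E₂ ≡ b ×
    EdgeMinimal 𝒥₀ E₁ E₂

  -- A total order on V^(i), given by a ranking function that is injective
  -- on i-subsets (X < Y iff rank X < rank Y).
  TotalOrderOn : ℕ → (Subset n → ℕ) → Set
  TotalOrderOn i rank = ∀ X Y → ∣ X ∣ ≡ i → ∣ Y ∣ ≡ i → rank X ≡ rank Y → X ≡ Y

  subB : Subset n → Subset n → Bool
  subB X e = does (X ⊆? e)

  memB : Subset n → List (Subset n) → Bool
  memB x = any (λ y → does (x ≟S y))

  insertBy : (Subset n → ℕ) → Subset n → List (Subset n) → List (Subset n)
  insertBy rk x [] = x ∷ []
  insertBy rk x (y ∷ ys) =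
    if rk x ≤ᵇ rk y then x ∷ y ∷ ys else y ∷ insertBy rk x ys

  sortBy : (Subset n → ℕ) → List (Subset n) → List (Subset n)
  sortBy rk [] = []
  sortBy rk (x ∷ xs) = insertBy rk x (sortBy rk xs)

  nth : List (Subset n) → ℕ → Maybe (Subset n)
  nth [] _ = nothing
  nth (x ∷ xs) zero = just x
  nth (x ∷ xs) (suc i) = nth xs i

  module Explore (σj σk : Subset n → ℕ) (𝒥₀ : List (Subset n)) where

    newIn : List (Subset n) → Subset n → List (Subset n)
    newIn done e = sortBy σj (filterᵇ (λ J → subB J e ∧ not (memB J done)) 𝒥₀)

    -- consider the edges es in turn: returns the new white list and the
    -- duties of the edges
    considerEdges : List (Subset n) → List (Subset n) → List (Subset n) × List ℕ
    considerEdges w [] = w , []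
    considerEdges w (e ∷ es) =
      let new = newIn w e
          rest = considerEdges (w ++ new) es
      in proj₁ rest , length new ∷ proj₂ rest

    -- fuel, index i of the active set (0-based), white list, considered edges
    redLoop : List (Subset n) → ℕ → ℕ → List (Subset n) → List (Subset n) →
              List (List ℕ) × List (Subset n)
    redLoop E₁ zero i w c = [] , w
    redLoop E₁ (suc f) i w c with nth w i
    ... | nothing = let rest = redLoop E₁ f (suc i) w c in [] ∷ proj₁ rest , proj₂ rest
    ... | just J =
      let es   = sortBy σk (filterᵇ (λ e → subB J e ∧ not (memB e c)) E₁)
          step = considerEdges w es
          rest = redLoop E₁ f (suc i) (proj₁ step) (c ++ es)
      in proj₂ step ∷ proj₁ rest , proj₂ rest

    initial : List (Subset n)
    initial with sortBy σj 𝒥₀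
    ... | [] = []
    ... | J ∷ _ = J ∷ []

    -- (rows of red duties, τ_σ(T)); ℓ rows
    red : ℕ → List (Subset n) → List (List ℕ) × List (Subset n)
    red ℓ E₁ = redLoop E₁ ℓ 0 initial []

    markEdges : List (Subset n) → List (Subset n) → List (Subset n) × List ℕ
    markEdges m [] = m , []
    markEdges m (e ∷ es) =
      let new = newIn m e
          rest = markEdges (m ++ new) es
      in proj₁ rest , length new ∷ proj₂ rest

    -- walk along τ = J_(i) ∷ J_(i+1) ∷ …; m = marked sets
    blueLoop : List (Subset n) → List (Subset n) → List (Subset n) → List (List ℕ)
    blueLoop E₂ [] m = []
    blueLoop E₂ (J ∷ later) m =
      let es = sortBy σk (filterᵇ (λ e → subB J e ∧ all (λ J' → not (subB J' e)) later) E₂)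
          step = markEdges m es
      in proj₂ step ∷ blueLoop E₂ later (proj₁ step)

    blue : List (Subset n) → List (Subset n) → List (List ℕ)
    blue τ E₂ = blueLoop E₂ τ initial

-- Matrices with rows 1..a and columns z = 0..c-1 (0-based in Agda)

Mat : ℕ → ℕ → Set
Mat a c = Fin a → Fin c → ℕ

Σ[<] : ∀ {m} → (Fin m → ℕ) → ℕ
Σ[<] {zero} h = 0
Σ[<] {suc m} h = h Fin.zero + Σ[<] (λ i → h (Fin.suc i))

fM : ∀ {a c} → Mat a c → ℕ
fM M = Σ[<] λ i → Σ[<] λ z → toℕ z * M i z

gM : ∀ {a c} → Mat a c → ℕ
gM M = Σ[<] λ i → Σ[<] λ z → M i z

Inℳ : ∀ {c} (a m : ℕ) → Mat a c → Set
Inℳ a m M = fM M ≡ a ∸ 1 × gM M ≡ m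

countEq : ℕ → List ℕ → ℕ
countEq z [] = 0
countEq z (d ∷ ds) = (if d ≡ᵇ z then 1 else 0) + countEq z ds

nthRow : List (List ℕ) → ℕ → List ℕ
nthRow [] _ = []
nthRow (r ∷ rs) zero = r
nthRow (r ∷ rs) (suc i) = nthRow rs i

-- matrix from rows of duty lists: entry (i,z) = #edges of duty z in row i
toMat : ∀ {a c} → List (List ℕ) → Mat a c
toMat rows i z = countEq (toℕ z) (nthRow rows (toℕ i))

open import Data.Nat.Combinatorics using (_C_)

blueprint : ∀ {n} (j k ℓ : ℕ) (σj σk : Subset n → ℕ) →
            (𝒥₀ E₁ E₂ : List (Subset n)) →
            Mat ℓ (suc (k C j)) × Mat ℓ (suc (k C j))
blueprint j k ℓ σj σk 𝒥₀ E₁ E₂ =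
  let open Explore σj σk 𝒥₀
      rd = red ℓ E₁
  in toMat (proj₁ rd) , toMat (blue (proj₂ rd) E₂)

module Submission where

-- The red exploration colours every set of 𝒥₀ white exactly once, J_(1) at the start and
-- every other one by exactly one red edge, and it considers every red edge exactly once;
-- so the duties in R add up to ℓ − 1 and there are r of them.  Exploration reaches all of
-- 𝒥₀ because the white sets and the considered edges are closed under each other and 𝒥₀
-- is traversable; every red edge is considered because, by edge-minimality, it contains a
-- set of 𝒥₀.  Blue marking is analogous: a blue edge is revealed exactly when the last
-- member of τ it contains is active, and every set of 𝒥₀ other than J_(1) lies in a blue
-- edge.  No duty exceeds C(k,j), the number of j-subsets of a k-edge, so f and g of the
-- blueprint matrices are the total duty and the number of duties.

open import Defs
open import Algebra.Properties.CommutativeSemigroup using (interchange)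
open import Data.Bool using (Bool; true; false; _∧_; _∨_; not; T; if_then_else_)
open import Data.Bool.ListAction using (any; all)
open import Data.Bool.Properties using (T?; T-∧)
open import Data.Empty using (⊥-elim)
open import Data.Fin using (Fin; toℕ)
open import Data.Fin.Subset using (Subset; _⊆_; ∣_∣)
open import Data.Fin.Subset.Properties using (_⊆?_; drop-∷-⊆)
open import Data.List using (List; []; _∷_; _++_; length; map; filterᵇ)
open import Data.List.Membership.Propositional using (_∈_; _∉_; find; lose)
open import Data.List.Membership.Propositional.Properties using (∈-∃++; ∈-++⁻; ∈-++⁺ˡ; ∈-++⁺ʳ; ∈-filter⁻; ∈-filter⁺)
open import Data.List.Properties using (length-++; ++-identityʳ; ++-assoc; filter-all; filter-none; map-id)
open import Data.List.Relation.Binary.Permutation.Propositional using (_↭_; ↭-refl; ↭-prep; ↭-swap; ↭-trans; ↭-sym; ↭⇒↭ₛ)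
open import Data.List.Relation.Binary.Permutation.Propositional.Properties using (∈-resp-↭; ↭-length)
import Data.List.Relation.Binary.Permutation.Setoid.Properties as ↭ₛ
open import Data.List.Relation.Binary.Subset.Propositional using () renaming (_⊆_ to _⊑_)
open import Data.List.Relation.Unary.All as All using (All; []; _∷_)
open import Data.List.Relation.Unary.All.Properties using (all⁻)
open import Data.List.Relation.Unary.AllPairs using ([]; _∷_)
import Data.List.Relation.Unary.Any as Any
open import Data.List.Relation.Unary.Any using (here; there)
open import Data.List.Relation.Unary.Any.Properties using (any⁺; any⁻)
open import Data.List.Relation.Unary.Unique.Propositional using (Unique)
import Data.List.Relation.Unary.Unique.Propositional.Properties as Unique
open import Data.Maybe using (just; nothing)
open import Data.Nat using (ℕ; zero; suc; _+_; _*_; _∸_; _≤_; _<_; z≤n; s≤s; _≡ᵇ_; _≤ᵇ_)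
open import Data.Nat.Combinatorics using (_C_; nCk+nC[k+1]≡[n+1]C[k+1])
open import Data.Nat.ListAction using (sum)
open import Data.Nat.Properties
open import Data.Product using (_×_; _,_; ∃; proj₁; proj₂)
open import Data.Sum using (_⊎_; inj₁; inj₂)
open import Data.Vec using (_∷_; []; here)
open import Function using (_∘_; case_of_)
open import Function.Bundles using (Equivalence)
open import Relation.Binary.PropositionalEquality
open import Relation.Nullary.Decidable using (Dec; does; yes; no; ¬?)
open import Relation.Nullary.Negation using (¬_)

private
  variable
    A : Set

-- Sums of matrix entries

Σ[<]-cong : ∀ {m} (h g : Fin m → ℕ) → (∀ i → h i ≡ g i) → Σ[<] h ≡ Σ[<] g
Σ[<]-cong {zero}  h g e = refl
Σ[<]-cong {suc m} h g e = cong₂ _+_ (e Fin.zero) (Σ[<]-cong (h ∘ Fin.suc) (g ∘ Fin.suc) (e ∘ Fin.suc))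

Σ[<]-zero : ∀ {m} (h : Fin m → ℕ) → (∀ i → h i ≡ 0) → Σ[<] h ≡ 0
Σ[<]-zero {zero}  h e = refl
Σ[<]-zero {suc m} h e = cong₂ _+_ (e Fin.zero) (Σ[<]-zero (h ∘ Fin.suc) (e ∘ Fin.suc))

Σ[<]-+ : ∀ {m} (h g : Fin m → ℕ) → Σ[<] (λ i → h i + g i) ≡ Σ[<] h + Σ[<] g
Σ[<]-+ {zero}  h g = refl
Σ[<]-+ {suc m} h g = trans (cong (h Fin.zero + g Fin.zero +_) (Σ[<]-+ (h ∘ Fin.suc) (g ∘ Fin.suc)))
                           (interchange +-commutativeSemigroup (h Fin.zero) (g Fin.zero) _ _)

Σ[<]-indicator : ∀ m d → d < m → (g : ℕ → ℕ) →
  Σ[<] {m} (λ z → g (toℕ z) * (if d ≡ᵇ toℕ z then 1 else 0)) ≡ g d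
Σ[<]-indicator (suc m) zero _ g = begin
  g 0 * 1 + Σ[<] {m} (λ z → g (suc (toℕ z)) * 0)
    ≡⟨ cong₂ _+_ (*-identityʳ (g 0))
                 (Σ[<]-zero {m} (λ z → g (suc (toℕ z)) * 0) (λ z → *-zeroʳ (g (suc (toℕ z))))) ⟩
  g 0 + 0
    ≡⟨ +-identityʳ (g 0) ⟩
  g 0 ∎
  where open ≡-Reasoning
Σ[<]-indicator (suc m) (suc d) (s≤s d<m) g =
  trans (cong (_+ Σ[<] {m} (λ z → g (suc (toℕ z)) * (if d ≡ᵇ toℕ z then 1 else 0))) (*-zeroʳ (g 0)))
        (Σ[<]-indicator m d d<m (g ∘ suc))

Σ[<]-weighted-countEq : ∀ K (g : ℕ → ℕ) ds → All (_≤ K) ds →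
  Σ[<] {suc K} (λ z → g (toℕ z) * countEq (toℕ z) ds) ≡ sum (map g ds)
Σ[<]-weighted-countEq K g [] [] = Σ[<]-zero {suc K} (λ z → g (toℕ z) * 0) (λ z → *-zeroʳ (g (toℕ z)))
Σ[<]-weighted-countEq K g (d ∷ ds) (d≤K ∷ ds≤K) = begin
  Σ[<] (λ z → g (toℕ z) * (δ z + c z))
    ≡⟨ Σ[<]-cong (λ z → g (toℕ z) * (δ z + c z)) (λ z → g (toℕ z) * δ z + g (toℕ z) * c z)
                 (λ z → *-distribˡ-+ (g (toℕ z)) (δ z) (c z)) ⟩
  Σ[<] (λ z → g (toℕ z) * δ z + g (toℕ z) * c z)
    ≡⟨ Σ[<]-+ (λ z → g (toℕ z) * δ z) (λ z → g (toℕ z) * c z) ⟩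
  Σ[<] (λ z → g (toℕ z) * δ z) + Σ[<] (λ z → g (toℕ z) * c z)
    ≡⟨ cong₂ _+_ (Σ[<]-indicator (suc K) d (s≤s d≤K) g) (Σ[<]-weighted-countEq K g ds ds≤K) ⟩
  g d + sum (map g ds) ∎
  where
  open ≡-Reasoning
  δ c : Fin (suc K) → ℕ
  δ z = if d ≡ᵇ toℕ z then 1 else 0
  c z = countEq (toℕ z) ds

Σ[<]-rows : ∀ {a} {P : List ℕ → Set} (F G : List ℕ → ℕ) → F [] ≡ 0 →
  (∀ {ds} → P ds → F ds ≡ G ds) → ∀ rows → length rows ≤ a → All P rows →
  Σ[<] {a} (λ i → F (nthRow rows (toℕ i))) ≡ sum (map G rows)
Σ[<]-rows {zero}  F G F[]≡0 F≡G []          _         _        = refl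
Σ[<]-rows {suc a} F G F[]≡0 F≡G []          _         _        =
  cong₂ _+_ F[]≡0 (Σ[<]-zero {a} (λ _ → F []) (λ _ → F[]≡0))
Σ[<]-rows {suc a} F G F[]≡0 F≡G (ds ∷ rows) (s≤s len) (p ∷ ps) =
  cong₂ _+_ (F≡G p) (Σ[<]-rows F G F[]≡0 F≡G rows len ps)

module _ {a K : ℕ} (rows : List (List ℕ)) (len : length rows ≤ a)
         (bounded : All (All (_≤ K)) rows) where

  fM-toMat : fM {a} {suc K} (toMat rows) ≡ sum (map sum rows)
  fM-toMat = Σ[<]-rows weight sum (Σ[<]-weighted-countEq K (λ z → z) [] [])
    (λ {ds} ds≤K → trans (Σ[<]-weighted-countEq K (λ z → z) ds ds≤K) (cong sum (map-id ds)))
    rows len bounded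
    where
    weight : List ℕ → ℕ
    weight ds = Σ[<] {suc K} (λ z → toℕ z * countEq (toℕ z) ds)

  gM-toMat : gM {a} {suc K} (toMat rows) ≡ sum (map length rows)
  gM-toMat = Σ[<]-rows count length (Σ[<]-zero {suc K} (λ _ → 0) (λ _ → refl))
    (λ {ds} ds≤K → trans (Σ[<]-cong {suc K} (λ z → countEq (toℕ z) ds) (λ z → 1 * countEq (toℕ z) ds)
                                     (λ z → sym (*-identityˡ _)))
                  (trans (Σ[<]-weighted-countEq K (λ _ → 1) ds ds≤K) (sum-map-const-1 ds)))
    rows len bounded
    where
    count : List ℕ → ℕ
    count ds = Σ[<] {suc K} (λ z → countEq (toℕ z) ds)
    sum-map-const-1 : ∀ (ds : List ℕ) → sum (map (λ _ → 1) ds) ≡ length ds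
    sum-map-const-1 []       = refl
    sum-map-const-1 (_ ∷ ds) = cong suc (sum-map-const-1 ds)

Unique-⊑⇒length≤ : ∀ {xs ys : List A} → Unique xs → xs ⊑ ys → length xs ≤ length ys
Unique-⊑⇒length≤ {xs = []}     _                _     = z≤n
Unique-⊑⇒length≤ {xs = x ∷ xs} (x∉xs ∷ !xs) xs⊑ys with ∈-∃++ (xs⊑ys (here refl))
... | us , vs , refl = begin
  suc (length xs)            ≤⟨ s≤s (Unique-⊑⇒length≤ !xs xs⊑us++vs) ⟩
  suc (length (us ++ vs))    ≡⟨ cong suc (length-++ us) ⟩
  suc (length us + length vs) ≡⟨ +-suc (length us) (length vs) ⟨
  length us + suc (length vs) ≡⟨ length-++ us ⟨
  length (us ++ x ∷ vs)      ∎
  where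
  open ≤-Reasoning
  xs⊑us++vs : xs ⊑ us ++ vs
  xs⊑us++vs y∈xs with ∈-++⁻ us (xs⊑ys (there y∈xs))
  ... | inj₁ y∈us         = ∈-++⁺ˡ y∈us
  ... | inj₂ (here refl)  = ⊥-elim (All.lookup x∉xs y∈xs refl)
  ... | inj₂ (there y∈vs) = ∈-++⁺ʳ us y∈vs

Unique-⊑-antisym⇒length≡ : ∀ {xs ys : List A} → Unique xs → Unique ys →
                           xs ⊑ ys → ys ⊑ xs → length xs ≡ length ys
Unique-⊑-antisym⇒length≡ !xs !ys xs⊑ys ys⊑xs =
  ≤-antisym (Unique-⊑⇒length≤ !xs xs⊑ys) (Unique-⊑⇒length≤ !ys ys⊑xs)

T-does⁻ : ∀ {P : Set} (P? : Dec P) → T (does P?) → P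
T-does⁻ (yes p) _ = p

T-does⁺ : ∀ {P : Set} (P? : Dec P) → P → T (does P?)
T-does⁺ (yes _)  _ = _
T-does⁺ (no ¬p) p = ¬p p

length≡1-∈⇒≡ : ∀ {xs : List A} {x y} → length xs ≡ 1 → x ∈ xs → y ∈ xs → x ≡ y
length≡1-∈⇒≡ {xs = _ ∷ []} _ (here refl) (here refl) = refl

module _ {n : ℕ} where

  T-subB : ∀ {X e : Subset n} → T (subB X e) → X ⊆ e
  T-subB {X} {e} = T-does⁻ (X ⊆? e)

  subB-T : ∀ {X e : Subset n} → X ⊆ e → T (subB X e)
  subB-T {X} {e} = T-does⁺ (X ⊆? e)

  T-memB : ∀ {x : Subset n} xs → T (memB x xs) → x ∈ xs
  T-memB {x} xs t = Any.map (T-does⁻ (x ≟S _)) (any⁻ _ xs t)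

  memB-T : ∀ {x : Subset n} xs → x ∈ xs → T (memB x xs)
  memB-T {x} xs x∈xs = any⁺ _ (Any.map (T-does⁺ (x ≟S _)) x∈xs)

  insertBy-↭ : ∀ rk (x : Subset n) ys → insertBy rk x ys ↭ x ∷ ys
  insertBy-↭ rk x []       = ↭-refl
  insertBy-↭ rk x (y ∷ ys) with rk x ≤ᵇ rk y
  ... | true  = ↭-refl
  ... | false = ↭-trans (↭-prep y (insertBy-↭ rk x ys)) (↭-swap y x ↭-refl)

  sortBy-↭ : ∀ rk (xs : List (Subset n)) → sortBy rk xs ↭ xs
  sortBy-↭ rk []       = ↭-refl
  sortBy-↭ rk (x ∷ xs) = ↭-trans (insertBy-↭ rk x (sortBy rk xs)) (↭-prep x (sortBy-↭ rk xs))

  nth-just : ∀ (w : List (Subset n)) t {J} → nth w t ≡ just J → J ∈ w × t < length w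
  nth-just (x ∷ w) zero    refl = here refl , s≤s z≤n
  nth-just (x ∷ w) (suc t) eq   = let (J∈w , t<) = nth-just w t eq in there J∈w , s≤s t<

  nth-nothing : ∀ (w : List (Subset n)) t → nth w t ≡ nothing → length w ≤ t
  nth-nothing []      t       _  = z≤n
  nth-nothing (x ∷ w) (suc t) eq = s≤s (nth-nothing w t eq)

  ∈⇒nth : ∀ {w : List (Subset n)} {J} → J ∈ w → ∃ λ t → nth w t ≡ just J
  ∈⇒nth (here refl) = zero , refl
  ∈⇒nth (there J∈w) = let (t , eq) = ∈⇒nth J∈w in suc t , eq

  nth-++ : ∀ (w X : List (Subset n)) {t} → t < length w → nth (w ++ X) t ≡ nth w t
  nth-++ (x ∷ w) X {zero}  _       = refl
  nth-++ (x ∷ w) X {suc t} (s≤s t<) = nth-++ w X t<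

  module _ (rk : Subset n → ℕ) (p : Subset n → Bool) (xs : List (Subset n)) where

    ∈-sortBy-filterᵇ⁻ : ∀ {x} → x ∈ sortBy rk (filterᵇ p xs) → x ∈ xs × T (p x)
    ∈-sortBy-filterᵇ⁻ x∈ = ∈-filter⁻ (T? ∘ p) (∈-resp-↭ (sortBy-↭ rk _) x∈)

    ∈-sortBy-filterᵇ⁺ : ∀ {x} → x ∈ xs → T (p x) → x ∈ sortBy rk (filterᵇ p xs)
    ∈-sortBy-filterᵇ⁺ x∈xs px = ∈-resp-↭ (↭-sym (sortBy-↭ rk _)) (∈-filter⁺ (T? ∘ p) x∈xs px)

    length-sortBy-filterᵇ : length (sortBy rk (filterᵇ p xs)) ≡ length (filterᵇ p xs)
    length-sortBy-filterᵇ = ↭-length (sortBy-↭ rk (filterᵇ p xs))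

    Unique-sortBy-filterᵇ : Unique xs → Unique (sortBy rk (filterᵇ p xs))
    Unique-sortBy-filterᵇ !xs = ↭ₛ.Unique-resp-↭ (setoid (Subset n)) (↭⇒↭ₛ (↭-sym (sortBy-↭ rk _)))
                                  (Unique.filter⁺ (T? ∘ p) !xs)

-- Counting j-subsets of a set

module _ {n : ℕ} where

  tailsInside tailsOutside : List (Subset (suc n)) → List (Subset n)
  tailsInside []                   = []
  tailsInside ((true  ∷ X) ∷ L)    = X ∷ tailsInside L
  tailsInside ((false ∷ X) ∷ L)    = tailsInside L
  tailsOutside []                  = []
  tailsOutside ((true  ∷ X) ∷ L)   = tailsOutside L
  tailsOutside ((false ∷ X) ∷ L)   = X ∷ tailsOutside L

  length-tails : ∀ L → length L ≡ length (tailsInside L) + length (tailsOutside L)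
  length-tails []                = refl
  length-tails ((true  ∷ X) ∷ L) = cong suc (length-tails L)
  length-tails ((false ∷ X) ∷ L) = trans (cong suc (length-tails L)) (sym (+-suc _ _))

  ∈-tailsInside⁻ : ∀ {X} L → X ∈ tailsInside L → (true ∷ X) ∈ L
  ∈-tailsInside⁻ ((true  ∷ _) ∷ L) (here refl) = here refl
  ∈-tailsInside⁻ ((true  ∷ _) ∷ L) (there X∈) = there (∈-tailsInside⁻ L X∈)
  ∈-tailsInside⁻ ((false ∷ _) ∷ L) X∈         = there (∈-tailsInside⁻ L X∈)

  ∈-tailsOutside⁻ : ∀ {X} L → X ∈ tailsOutside L → (false ∷ X) ∈ L
  ∈-tailsOutside⁻ ((true  ∷ _) ∷ L) X∈         = there (∈-tailsOutside⁻ L X∈)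
  ∈-tailsOutside⁻ ((false ∷ _) ∷ L) (here refl) = here refl
  ∈-tailsOutside⁻ ((false ∷ _) ∷ L) (there X∈) = there (∈-tailsOutside⁻ L X∈)

  Unique-tailsInside : ∀ {L} → Unique L → Unique (tailsInside L)
  Unique-tailsInside {[]}              []         = []
  Unique-tailsInside {(true  ∷ X) ∷ L} (X∉ ∷ !L) =
    All.tabulate (λ Y∈ X≡Y → All.lookup X∉ (∈-tailsInside⁻ L Y∈) (cong (true ∷_) X≡Y))
    ∷ Unique-tailsInside !L
  Unique-tailsInside {(false ∷ X) ∷ L} (_  ∷ !L) = Unique-tailsInside !L

  Unique-tailsOutside : ∀ {L} → Unique L → Unique (tailsOutside L)
  Unique-tailsOutside {[]}              []         = []
  Unique-tailsOutside {(true  ∷ X) ∷ L} (_  ∷ !L) = Unique-tailsOutside !L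
  Unique-tailsOutside {(false ∷ X) ∷ L} (X∉ ∷ !L) =
    All.tabulate (λ Y∈ X≡Y → All.lookup X∉ (∈-tailsOutside⁻ L Y∈) (cong (false ∷_) X≡Y))
    ∷ Unique-tailsOutside !L

empty⇒length≡0 : ∀ {xs : List A} → (∀ {x} → x ∉ xs) → length xs ≡ 0
empty⇒length≡0 {xs = []}    _    = refl
empty⇒length≡0 {xs = x ∷ _} none = ⊥-elim (none (here refl))

Unique-subsets-length≤C : ∀ {n} j (e : Subset n) {L} → Unique L →
  (∀ {X} → X ∈ L → ∣ X ∣ ≡ j × X ⊆ e) → length L ≤ ∣ e ∣ C j
Unique-subsets-length≤C j       [] {[]}          _ _ = z≤n
Unique-subsets-length≤C zero    [] {[] ∷ []}     _ _ = ≤-refl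
Unique-subsets-length≤C (suc j) [] {[] ∷ []}     _ sub with () ← proj₁ (sub (here refl))
Unique-subsets-length≤C j       [] {[] ∷ [] ∷ _} ((≢[] ∷ _) ∷ _) _ = ⊥-elim (≢[] refl)
Unique-subsets-length≤C {suc n} j (b ∷ e) {L} !L sub = begin
  length L                                          ≡⟨ length-tails L ⟩
  length (tailsInside L) + length (tailsOutside L)  ≤⟨ +-monoʳ-≤ _ outside≤ ⟩
  length (tailsInside L) + ∣ e ∣ C j                ≤⟨ inside-bound j b sub ⟩
  ∣ b ∷ e ∣ C j                                     ∎
  where
  open ≤-Reasoning
  outside≤ : length (tailsOutside L) ≤ ∣ e ∣ C j
  outside≤ = Unique-subsets-length≤C j e (Unique-tailsOutside !L) λ X∈ →
    let (size , ⊆e) = sub (∈-tailsOutside⁻ L X∈) in size , drop-∷-⊆ ⊆e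
  inside-bound : ∀ j b → (∀ {X} → X ∈ L → ∣ X ∣ ≡ j × X ⊆ b ∷ e) →
            length (tailsInside L) + ∣ e ∣ C j ≤ ∣ b ∷ e ∣ C j
  inside-bound zero b sub = ≤-reflexive (cong (_+ 1) (empty⇒length≡0 λ X∈ →
    case proj₁ (sub (∈-tailsInside⁻ L X∈)) of λ ()))
  inside-bound (suc j) true sub = ≤-trans
    (+-monoˡ-≤ _ (Unique-subsets-length≤C j e (Unique-tailsInside !L) λ X∈ →
      let (size , ⊆e) = sub (∈-tailsInside⁻ L X∈) in suc-injective size , drop-∷-⊆ ⊆e))
    (≤-reflexive (nCk+nC[k+1]≡[n+1]C[k+1] ∣ e ∣ j))
  inside-bound (suc j) false sub = ≤-reflexive (cong (_+ ∣ e ∣ C suc j) (empty⇒length≡0 λ X∈ →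
    case proj₂ (sub (∈-tailsInside⁻ L X∈)) here of λ ()))

-- One round of colouring (or marking)

T-not⁺ : ∀ {b} → ¬ T b → T (not b)
T-not⁺ {false} _  = _
T-not⁺ {true}  ¬b = ¬b _

T-∧-not⁻ : ∀ {a b} → T (a ∧ not b) → T a × ¬ T b
T-∧-not⁻ {true} {false} _ = _ , λ ()

T-∧-not⁺ : ∀ {a b} → T a → ¬ T b → T (a ∧ not b)
T-∧-not⁺ {true} {false} _ _  = _
T-∧-not⁺ {true} {true}  _ ¬b = ¬b _

module Colouring {n : ℕ} (σj σk : Subset n → ℕ) (𝒥₀ : List (Subset n)) (!𝒥₀ : Unique 𝒥₀) where
  open Explore σj σk 𝒥₀

  ∈-newIn⁻ : ∀ done e {J} → J ∈ newIn done e → J ∈ 𝒥₀ × J ⊆ e × J ∉ done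
  ∈-newIn⁻ done e J∈ with ∈-sortBy-filterᵇ⁻ σj _ 𝒥₀ J∈
  ... | J∈𝒥₀ , t with T-∧-not⁻ t
  ... | J⊆e , J∉ = J∈𝒥₀ , T-subB J⊆e , J∉ ∘ memB-T done

  ∈-newIn⁺ : ∀ done e {J} → J ∈ 𝒥₀ → J ⊆ e → J ∉ done → J ∈ newIn done e
  ∈-newIn⁺ done e J∈𝒥₀ J⊆e J∉ =
    ∈-sortBy-filterᵇ⁺ σj _ 𝒥₀ J∈𝒥₀ (T-∧-not⁺ (subB-T J⊆e) (J∉ ∘ T-memB done))

  Unique-newIn : ∀ done e → Unique (newIn done e)
  Unique-newIn done e = Unique-sortBy-filterᵇ σj _ 𝒥₀ !𝒥₀

  length-newIn≤C : ∀ {j k} done e → (∀ {J} → J ∈ 𝒥₀ → ∣ J ∣ ≡ j) → ∣ e ∣ ≡ k →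
                   length (newIn done e) ≤ k C j
  length-newIn≤C {j} done e size₀ refl = Unique-subsets-length≤C j e (Unique-newIn done e) λ J∈ →
    let (J∈𝒥₀ , J⊆e , _) = ∈-newIn⁻ done e J∈ in size₀ J∈𝒥₀ , J⊆e

  initial-singleton : 0 < length 𝒥₀ → ∃ λ J₀ → J₀ ∈ 𝒥₀ × initial ≡ J₀ ∷ []
  initial-singleton 0<ℓ with sortBy σj 𝒥₀ in sorted≡
  ... | []    = ⊥-elim (<⇒≢ 0<ℓ (trans (cong length (sym sorted≡)) (↭-length (sortBy-↭ σj 𝒥₀))))
  ... | J ∷ _ = J , ∈-resp-↭ (sortBy-↭ σj 𝒥₀) (subst (J ∈_) (sym sorted≡) (here refl)) , refl

  whites : List (Subset n) → List (Subset n) → List (Subset n)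
  whites w es = proj₁ (considerEdges w es)

  duties : List (Subset n) → List (Subset n) → List ℕ
  duties w es = proj₂ (considerEdges w es)

  whites-++ : ∀ w es → ∃ λ X → whites w es ≡ w ++ X
  whites-++ w []       = [] , sym (++-identityʳ w)
  whites-++ w (e ∷ es) with whites-++ (w ++ newIn w e) es
  ... | X , eq = newIn w e ++ X , trans eq (++-assoc w _ X)

  ⊑-whites : ∀ w es → w ⊑ whites w es
  ⊑-whites w es J∈ with whites-++ w es
  ... | X , eq = subst (_ ∈_) (sym eq) (∈-++⁺ˡ J∈)

  length-whites : ∀ w es → length (whites w es) ≡ length w + sum (duties w es)
  length-whites w []       = sym (+-identityʳ _)
  length-whites w (e ∷ es) = begin
    length (whites (w ++ newIn w e) es)
      ≡⟨ length-whites (w ++ newIn w e) es ⟩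
    length (w ++ newIn w e) + sum (duties (w ++ newIn w e) es)
      ≡⟨ cong (_+ sum (duties (w ++ newIn w e) es)) (length-++ w) ⟩
    (length w + length (newIn w e)) + sum (duties (w ++ newIn w e) es)
      ≡⟨ +-assoc (length w) _ _ ⟩
    length w + sum (duties w (e ∷ es)) ∎
    where open ≡-Reasoning

  length-duties : ∀ w es → length (duties w es) ≡ length es
  length-duties w []       = refl
  length-duties w (e ∷ es) = cong suc (length-duties (w ++ newIn w e) es)

  whites-Unique-⊑ : ∀ w es → Unique w → w ⊑ 𝒥₀ → Unique (whites w es) × whites w es ⊑ 𝒥₀
  whites-Unique-⊑ w []       !w w⊑ = !w , w⊑
  whites-Unique-⊑ w (e ∷ es) !w w⊑ = whites-Unique-⊑ (w ++ newIn w e) es !w++new w++new⊑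
    where
    !w++new : Unique (w ++ newIn w e)
    !w++new = Unique.++⁺ !w (Unique-newIn w e) λ (J∈w , J∈new) →
      proj₂ (proj₂ (∈-newIn⁻ w e J∈new)) J∈w
    w++new⊑ : w ++ newIn w e ⊑ 𝒥₀
    w++new⊑ J∈ with ∈-++⁻ w J∈
    ... | inj₁ J∈w   = w⊑ J∈w
    ... | inj₂ J∈new = proj₁ (∈-newIn⁻ w e J∈new)

  whites-cover : ∀ w es {e J} → e ∈ es → J ∈ 𝒥₀ → J ⊆ e → J ∈ whites w es
  whites-cover w (e ∷ es) {J = J} (here refl) J∈𝒥₀ J⊆e with T? (memB J w)
  ... | yes J∈w = ⊑-whites (w ++ newIn w e) es (∈-++⁺ˡ (T-memB w J∈w))
  ... | no  J∉w = ⊑-whites (w ++ newIn w e) es (∈-++⁺ʳ w (∈-newIn⁺ w e J∈𝒥₀ J⊆e (J∉w ∘ memB-T w)))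
  whites-cover w (_ ∷ es) (there e∈) J∈𝒥₀ J⊆e = whites-cover (w ++ newIn w _) es e∈ J∈𝒥₀ J⊆e

  duties≤C : ∀ {j k} w es → (∀ {J} → J ∈ 𝒥₀ → ∣ J ∣ ≡ j) → All (λ e → ∣ e ∣ ≡ k) es →
             All (_≤ k C j) (duties w es)
  duties≤C w []       size₀ []            = []
  duties≤C w (e ∷ es) size₀ (∣e∣ ∷ ∣es∣) =
    length-newIn≤C w e size₀ ∣e∣ ∷ duties≤C (w ++ newIn w e) es size₀ ∣es∣

  markEdges≡considerEdges : ∀ m es → markEdges m es ≡ considerEdges m es
  markEdges≡considerEdges m []       = refl
  markEdges≡considerEdges m (e ∷ es) rewrite markEdges≡considerEdges (m ++ newIn m e) es = refl

-- Traversability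

module _ {n : ℕ} {𝒥 E : List (Subset n)} where

  Chain-closed : ∀ {W C : List (Subset n)} →
    (∀ {J e} → J ∈ W → e ∈ E → J ⊆ e → e ∈ C) →
    (∀ {e J} → e ∈ C → J ∈ 𝒥 → J ⊆ e → J ∈ W) →
    ∀ {J J′ e} → e ∈ E → J ∈ W → J ⊆ e → J′ ∈ 𝒥 → Chain 𝒥 E J′ e → J′ ∈ W
  Chain-closed W→C C→W e∈E J∈W J⊆e J′∈𝒥 (end J′⊆e) = C→W (W→C J∈W e∈E J⊆e) J′∈𝒥 J′⊆e
  Chain-closed W→C C→W e∈E J∈W J⊆e J′∈𝒥 (step e′∈E Ji∈𝒥 Ji⊆e Ji⊆e′ chain) =
    Chain-closed W→C C→W e′∈E (C→W (W→C J∈W e∈E J⊆e) Ji∈𝒥 Ji⊆e) Ji⊆e′ J′∈𝒥 chain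

  Traversable-closed⇒⊑ : ∀ {W C J₀} → Traversable 𝒥 E → J₀ ∈ 𝒥 → J₀ ∈ W →
    (∀ {J e} → J ∈ W → e ∈ E → J ⊆ e → e ∈ C) →
    (∀ {e J} → e ∈ C → J ∈ 𝒥 → J ⊆ e → J ∈ W) → 𝒥 ⊑ W
  Traversable-closed⇒⊑ {J₀ = J₀} trav J₀∈𝒥 J₀∈W W→C C→W {J} J∈𝒥 with J ≟S J₀ | trav
  ... | yes refl | _        = J₀∈W
  ... | no  J≢J₀ | inj₁ |𝒥|≡1 = ⊥-elim (J≢J₀ (length≡1-∈⇒≡ |𝒥|≡1 J∈𝒥 J₀∈𝒥))
  ... | no  J≢J₀ | inj₂ path with path J₀ J J₀∈𝒥 J∈𝒥 (J≢J₀ ∘ sym)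
  ...   | e , e∈E , J₀⊆e , chain = Chain-closed W→C C→W e∈E J₀∈W J₀⊆e J∈𝒥 chain

  Traversable⇒edge-∋ : ∀ {J₀ J} → Traversable 𝒥 E → J₀ ∈ 𝒥 → J ∈ 𝒥 →
                       J ≡ J₀ ⊎ ∃ λ e → e ∈ E × J ⊆ e
  Traversable⇒edge-∋ {J₀} {J} trav J₀∈𝒥 J∈𝒥 with J ≟S J₀ | trav
  ... | yes J≡J₀ | _          = inj₁ J≡J₀
  ... | no  J≢J₀ | inj₁ |𝒥|≡1 = inj₁ (length≡1-∈⇒≡ |𝒥|≡1 J∈𝒥 J₀∈𝒥)
  ... | no  J≢J₀ | inj₂ path with path J J₀ J∈𝒥 J₀∈𝒥 J≢J₀
  ...   | e , e∈E , J⊆e , _ = inj₂ (e , e∈E , J⊆e)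

  remove-Traversable : ∀ {e} → (∀ {J} → J ∈ 𝒥 → ¬ J ⊆ e) →
                       Traversable 𝒥 E → Traversable 𝒥 (remove e E)
  remove-Traversable {e} e∌ (inj₁ |𝒥|≡1) = inj₁ |𝒥|≡1
  remove-Traversable {e} e∌ (inj₂ path) = inj₂ λ J J′ J∈𝒥 J′∈𝒥 J≢J′ →
    let (e₁ , e₁∈E , J⊆e₁ , chain) = path J J′ J∈𝒥 J′∈𝒥 J≢J′
    in e₁ , kept e₁∈E (λ { refl → e∌ J∈𝒥 J⊆e₁ }) , J⊆e₁ , avoid chain
    where
    kept : ∀ {x} → x ∈ E → x ≢ e → x ∈ remove e E
    kept x∈E x≢e = ∈-filter⁺ (λ x → ¬? (x ≟S e)) x∈E x≢e
    avoid : ∀ {J′ e₁} → Chain 𝒥 E J′ e₁ → Chain 𝒥 (remove e E) J′ e₁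
    avoid (end J′⊆e₁) = end J′⊆e₁
    avoid (step e′∈E Ji∈𝒥 Ji⊆e₁ Ji⊆e′ chain) =
      step (kept e′∈E (λ { refl → e∌ Ji∈𝒥 Ji⊆e′ })) Ji∈𝒥 Ji⊆e₁ Ji⊆e′ (avoid chain)

  essential-edge-∋ : ∀ {e} → Traversable 𝒥 E → ¬ Traversable 𝒥 (remove e E) →
                     ∃ λ J → J ∈ 𝒥 × J ⊆ e
  essential-edge-∋ {e} trav ¬trav with Any.any? (_⊆? e) 𝒥
  ... | yes J⊆e = find J⊆e
  ... | no  none = ⊥-elim (¬trav (remove-Traversable (λ J∈𝒥 J⊆e → none (lose J∈𝒥 J⊆e)) trav))

-- The red exploration

module RedExploration {n : ℕ} (σj σk : Subset n → ℕ) (𝒥₀ : List (Subset n)) (!𝒥₀ : Unique 𝒥₀)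
                      (E₁ : List (Subset n)) (!E₁ : Unique E₁) where
  open Explore σj σk 𝒥₀
  open Colouring σj σk 𝒥₀ !𝒥₀

  newEdges : Subset n → List (Subset n) → List (Subset n)
  newEdges J c = sortBy σk (filterᵇ (λ e → subB J e ∧ not (memB e c)) E₁)

  ∈-newEdges⁻ : ∀ J c {e} → e ∈ newEdges J c → e ∈ E₁ × J ⊆ e × e ∉ c
  ∈-newEdges⁻ J c e∈ with ∈-sortBy-filterᵇ⁻ σk _ E₁ e∈
  ... | e∈E₁ , t with T-∧-not⁻ t
  ... | J⊆e , e∉ = e∈E₁ , T-subB J⊆e , e∉ ∘ memB-T c

  ∈-newEdges⁺ : ∀ J c {e} → e ∈ E₁ → J ⊆ e → e ∉ c → e ∈ newEdges J c
  ∈-newEdges⁺ J c e∈E₁ J⊆e e∉c = ∈-sortBy-filterᵇ⁺ σk _ E₁ e∈E₁ (T-∧-not⁺ (subB-T J⊆e) (e∉c ∘ T-memB c))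

  rows : ℕ → ℕ → List (Subset n) → List (Subset n) → List (List ℕ)
  rows f i w c = proj₁ (redLoop E₁ f i w c)

  order : ℕ → ℕ → List (Subset n) → List (Subset n) → List (Subset n)
  order f i w c = proj₂ (redLoop E₁ f i w c)

  considered : ℕ → ℕ → List (Subset n) → List (Subset n) → List (Subset n)
  considered zero    i w c = c
  considered (suc f) i w c with nth w i
  ... | nothing = considered f (suc i) w c
  ... | just J  = considered f (suc i) (whites w (newEdges J c)) (c ++ newEdges J c)

  length-rows : ∀ f i w c → length (rows f i w c) ≡ f
  length-rows zero    i w c = refl
  length-rows (suc f) i w c with nth w i
  ... | nothing = cong suc (length-rows f (suc i) w c)
  ... | just J  = cong suc (length-rows f (suc i) _ _)

  rows-sum : ∀ f i w c → length w + sum (map sum (rows f i w c)) ≡ length (order f i w c)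
  rows-sum zero    i w c = +-identityʳ (length w)
  rows-sum (suc f) i w c with nth w i
  ... | nothing = rows-sum f (suc i) w c
  ... | just J  = begin
    length w + (sum (duties w es) + sum (map sum (rows f (suc i) w′ c′)))
      ≡⟨ +-assoc (length w) _ _ ⟨
    (length w + sum (duties w es)) + sum (map sum (rows f (suc i) w′ c′))
      ≡⟨ cong (_+ sum (map sum (rows f (suc i) w′ c′))) (length-whites w es) ⟨
    length w′ + sum (map sum (rows f (suc i) w′ c′))
      ≡⟨ rows-sum f (suc i) w′ c′ ⟩
    length (order f (suc i) w′ c′) ∎
    where
    open ≡-Reasoning
    es w′ c′ : List (Subset n)
    es = newEdges J c
    w′ = whites w es
    c′ = c ++ es

  rows-count : ∀ f i w c → length c + sum (map length (rows f i w c)) ≡ length (considered f i w c)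
  rows-count zero    i w c = +-identityʳ (length c)
  rows-count (suc f) i w c with nth w i
  ... | nothing = rows-count f (suc i) w c
  ... | just J  = begin
    length c + (length (duties w es) + sum (map length (rows f (suc i) w′ c′)))
      ≡⟨ +-assoc (length c) _ _ ⟨
    (length c + length (duties w es)) + sum (map length (rows f (suc i) w′ c′))
      ≡⟨ cong (λ x → length c + x + sum (map length (rows f (suc i) w′ c′))) (length-duties w es) ⟩
    (length c + length es) + sum (map length (rows f (suc i) w′ c′))
      ≡⟨ cong (_+ sum (map length (rows f (suc i) w′ c′))) (length-++ c) ⟨
    length c′ + sum (map length (rows f (suc i) w′ c′))
      ≡⟨ rows-count f (suc i) w′ c′ ⟩
    length (considered f (suc i) w′ c′) ∎
    where
    open ≡-Reasoning
    es w′ c′ : List (Subset n)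
    es = newEdges J c
    w′ = whites w es
    c′ = c ++ es

  rows≤C : ∀ {j k} f i w c → (∀ {J} → J ∈ 𝒥₀ → ∣ J ∣ ≡ j) → (∀ {e} → e ∈ E₁ → ∣ e ∣ ≡ k) →
           All (All (_≤ k C j)) (rows f i w c)
  rows≤C zero    i w c size₀ size₁ = []
  rows≤C (suc f) i w c size₀ size₁ with nth w i
  ... | nothing = [] ∷ rows≤C f (suc i) w c size₀ size₁
  ... | just J  =
    duties≤C w (newEdges J c) size₀ (All.tabulate (size₁ ∘ proj₁ ∘ ∈-newEdges⁻ J c))
    ∷ rows≤C f (suc i) _ _ size₀ size₁

  record Invariant (J₀ : Subset n) (i : ℕ) (w c : List (Subset n)) : Set where
    field
      white-unique      : Unique w
      white⊑𝒥₀          : w ⊑ 𝒥₀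
      considered-unique : Unique c
      considered⊑E₁     : c ⊑ E₁
      start-white       : J₀ ∈ w
      considered-closed : ∀ {e J} → e ∈ c → J ∈ 𝒥₀ → J ⊆ e → J ∈ w
      active-explored   : ∀ {t J e} → t < i → nth w t ≡ just J → e ∈ E₁ → J ⊆ e → e ∈ c
  open Invariant

  idle-step : ∀ {J₀ i w c} → nth w i ≡ nothing → Invariant J₀ i w c → Invariant J₀ (suc i) w c
  idle-step {w = w} nth≡ inv = record
    { white-unique      = white-unique inv
    ; white⊑𝒥₀          = white⊑𝒥₀ inv
    ; considered-unique = considered-unique inv
    ; considered⊑E₁     = considered⊑E₁ inv
    ; start-white       = start-white inv
    ; considered-closed = considered-closed inv
    ; active-explored   = λ {t} _ nt →
        active-explored inv (<-≤-trans (proj₂ (nth-just w t nt)) (nth-nothing w _ nth≡)) nt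
    }

  active-step : ∀ {J₀ i w c J} → nth w i ≡ just J → Invariant J₀ i w c →
                Invariant J₀ (suc i) (whites w (newEdges J c)) (c ++ newEdges J c)
  active-step {J₀} {i} {w} {c} {J} nth≡ inv = record
    { white-unique      = proj₁ whites-inv
    ; white⊑𝒥₀          = proj₂ whites-inv
    ; considered-unique = Unique.++⁺ (considered-unique inv) (Unique-sortBy-filterᵇ σk _ E₁ !E₁)
                            λ (e∈c , e∈es) → proj₂ (proj₂ (∈-newEdges⁻ J c e∈es)) e∈c
    ; considered⊑E₁     = c′⊑E₁
    ; start-white       = ⊑-whites w es (start-white inv)
    ; considered-closed = closed
    ; active-explored   = explored
    }
    where
    es : List (Subset n)
    es = newEdges J c
    whites-inv : Unique (whites w es) × whites w es ⊑ 𝒥₀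
    whites-inv = whites-Unique-⊑ w es (white-unique inv) (white⊑𝒥₀ inv)
    c′⊑E₁ : c ++ es ⊑ E₁
    c′⊑E₁ e∈ with ∈-++⁻ c e∈
    ... | inj₁ e∈c  = considered⊑E₁ inv e∈c
    ... | inj₂ e∈es = proj₁ (∈-newEdges⁻ J c e∈es)
    closed : ∀ {e J′} → e ∈ c ++ es → J′ ∈ 𝒥₀ → J′ ⊆ e → J′ ∈ whites w es
    closed e∈ J′∈𝒥₀ J′⊆e with ∈-++⁻ c e∈
    ... | inj₁ e∈c  = ⊑-whites w es (considered-closed inv e∈c J′∈𝒥₀ J′⊆e)
    ... | inj₂ e∈es = whites-cover w es e∈es J′∈𝒥₀ J′⊆e
    explored : ∀ {t J′ e} → t < suc i → nth (whites w es) t ≡ just J′ → e ∈ E₁ → J′ ⊆ e → e ∈ c ++ es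
    explored {t} {J′} {e} (s≤s t≤i) nt e∈E₁ J′⊆e with whites-++ w es
    ... | X , eq with trans (sym (nth-++ w X (≤-<-trans t≤i (proj₂ (nth-just w i nth≡)))))
                            (trans (cong (λ v → nth v t) (sym eq)) nt)
    ... | nt′ with m≤n⇒m<n∨m≡n t≤i
    ... | inj₁ t<i = ∈-++⁺ˡ (active-explored inv t<i nt′ e∈E₁ J′⊆e)
    ... | inj₂ refl with trans (sym nth≡) nt′
    ... | refl with T? (memB e c)
    ... | yes e∈c = ∈-++⁺ˡ (T-memB c e∈c)
    ... | no  e∉c = ∈-++⁺ʳ c (∈-newEdges⁺ J c e∈E₁ J′⊆e (e∉c ∘ memB-T c))

  loop-invariant : ∀ {J₀} f i w c → Invariant J₀ i w c →
                   Invariant J₀ (f + i) (order f i w c) (considered f i w c)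
  loop-invariant         zero    i w c inv = inv
  loop-invariant {J₀} (suc f) i w c inv with nth w i in nth≡
  ... | nothing = subst (λ x → Invariant J₀ x (order f (suc i) w c) (considered f (suc i) w c))
                    (+-suc f i) (loop-invariant f (suc i) w c (idle-step nth≡ inv))
  ... | just J  = subst (λ x → Invariant J₀ x (order f (suc i) w′ c′) (considered f (suc i) w′ c′))
                    (+-suc f i) (loop-invariant f (suc i) w′ c′ (active-step nth≡ inv))
    where
    w′ c′ : List (Subset n)
    w′ = whites w (newEdges J c)
    c′ = c ++ newEdges J c

  module _ {J₀ : Subset n} (J₀∈𝒥₀ : J₀ ∈ 𝒥₀) (initial≡ : initial ≡ J₀ ∷ [])
           (traversable : Traversable 𝒥₀ E₁) where

    private
      ℓ : ℕ
      ℓ = length 𝒥₀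
      τ c : List (Subset n)
      τ = order ℓ 0 initial []
      c = considered ℓ 0 initial []

      start : Invariant J₀ 0 initial []
      start rewrite initial≡ = record
        { white-unique      = [] ∷ []
        ; white⊑𝒥₀          = λ { (here refl) → J₀∈𝒥₀ }
        ; considered-unique = []
        ; considered⊑E₁     = λ ()
        ; start-white       = here refl
        ; considered-closed = λ ()
        ; active-explored   = λ ()
        }

      final : Invariant J₀ (ℓ + 0) τ c
      final = loop-invariant ℓ 0 initial [] start

      τ-explored : ∀ {J e} → J ∈ τ → e ∈ E₁ → J ⊆ e → e ∈ c
      τ-explored J∈τ with ∈⇒nth J∈τ
      ... | t , nt = active-explored final (<-≤-trans (proj₂ (nth-just τ t nt)) length-τ≤) nt
        where
        length-τ≤ : length τ ≤ ℓ + 0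
        length-τ≤ = ≤-trans (Unique-⊑⇒length≤ (white-unique final) (white⊑𝒥₀ final))
                            (≤-reflexive (sym (+-identityʳ ℓ)))

    𝒥₀⊑order : 𝒥₀ ⊑ τ
    𝒥₀⊑order = Traversable-closed⇒⊑ traversable J₀∈𝒥₀ (start-white final)
                 τ-explored (considered-closed final)

    length-order : length τ ≡ length 𝒥₀
    length-order = Unique-⊑-antisym⇒length≡ (white-unique final) !𝒥₀ (white⊑𝒥₀ final) 𝒥₀⊑order

    red-duty-total : 1 + sum (map sum (rows ℓ 0 initial [])) ≡ length 𝒥₀
    red-duty-total = begin
      1 + sum (map sum (rows ℓ 0 initial []))
        ≡⟨ cong (λ w → length w + sum (map sum (rows ℓ 0 initial []))) initial≡ ⟨
      length initial + sum (map sum (rows ℓ 0 initial []))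
        ≡⟨ rows-sum ℓ 0 initial [] ⟩
      length τ
        ≡⟨ length-order ⟩
      length 𝒥₀ ∎
      where open ≡-Reasoning

    red-edge-count : (∀ {e} → e ∈ E₁ → ∃ λ J → J ∈ 𝒥₀ × J ⊆ e) →
                     sum (map length (rows ℓ 0 initial [])) ≡ length E₁
    red-edge-count meets = trans (rows-count ℓ 0 initial [])
      (Unique-⊑-antisym⇒length≡ (considered-unique final) !E₁ (considered⊑E₁ final) E₁⊑c)
      where
      E₁⊑c : E₁ ⊑ c
      E₁⊑c e∈E₁ = let (J , J∈𝒥₀ , J⊆e) = meets e∈E₁ in τ-explored (𝒥₀⊑order J∈𝒥₀) e∈E₁ J⊆e

-- The blue marking

countᵇ : (A → Bool) → List A → ℕ
countᵇ p xs = length (filterᵇ p xs)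

countᵇ-cong : ∀ {p q : A → Bool} → (∀ x → p x ≡ q x) → ∀ xs → countᵇ p xs ≡ countᵇ q xs
countᵇ-cong             p≗q []       = refl
countᵇ-cong {p = p} {q} p≗q (x ∷ xs) with p x | q x | p≗q x
... | true  | .true  | refl = cong suc (countᵇ-cong p≗q xs)
... | false | .false | refl = countᵇ-cong p≗q xs

countᵇ-∧-not-+ : ∀ (p q : A → Bool) xs →
  countᵇ (λ x → p x ∧ not (q x)) xs + countᵇ q xs ≡ countᵇ (λ x → p x ∨ q x) xs
countᵇ-∧-not-+ p q []       = refl
countᵇ-∧-not-+ p q (x ∷ xs) with p x | q x
... | true  | true  = trans (+-suc _ _) (cong suc (countᵇ-∧-not-+ p q xs))
... | true  | false = cong suc (countᵇ-∧-not-+ p q xs)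
... | false | true  = trans (+-suc _ _) (cong suc (countᵇ-∧-not-+ p q xs))
... | false | false = countᵇ-∧-not-+ p q xs

countᵇ-false : ∀ (xs : List A) → countᵇ (λ _ → false) xs ≡ 0
countᵇ-false xs = cong length (filter-none (T? ∘ (λ _ → false)) {xs} (All.tabulate (λ _ ())))

countᵇ-all : ∀ (p : A → Bool) {xs : List A} → All (T ∘ p) xs → countᵇ p xs ≡ length xs
countᵇ-all p {xs} all-p = cong length (filter-all (T? ∘ p) {xs} all-p)

all-not≡not-any : ∀ (p : A → Bool) xs → all (not ∘ p) xs ≡ not (any p xs)
all-not≡not-any p []       = refl
all-not≡not-any p (x ∷ xs) with p x
... | true  = refl
... | false = all-not≡not-any p xs

module BlueMarking {n : ℕ} (σj σk : Subset n → ℕ) (𝒥₀ : List (Subset n)) (!𝒥₀ : Unique 𝒥₀)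
                   (E₂ : List (Subset n)) where
  open Explore σj σk 𝒥₀
  open Colouring σj σk 𝒥₀ !𝒥₀

  revealable : Subset n → List (Subset n) → Subset n → Bool
  revealable J later e = subB J e ∧ all (λ J′ → not (subB J′ e)) later

  revealed : Subset n → List (Subset n) → List (Subset n)
  revealed J later = sortBy σk (filterᵇ (revealable J later) E₂)

  marked : List (Subset n) → List (Subset n) → List (Subset n)
  marked []          m = m
  marked (J ∷ later) m = marked later (whites m (revealed J later))

  length-blueLoop : ∀ τ m → length (blueLoop E₂ τ m) ≡ length τ
  length-blueLoop []          m = refl
  length-blueLoop (J ∷ later) m = cong suc (length-blueLoop later _)

  blueLoop-sum : ∀ τ m → length m + sum (map sum (blueLoop E₂ τ m)) ≡ length (marked τ m)
  blueLoop-sum []          m = +-identityʳ (length m)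
  blueLoop-sum (J ∷ later) m rewrite markEdges≡considerEdges m (revealed J later) = begin
    length m + (sum (duties m es) + sum (map sum (blueLoop E₂ later m′)))
      ≡⟨ +-assoc (length m) _ _ ⟨
    (length m + sum (duties m es)) + sum (map sum (blueLoop E₂ later m′))
      ≡⟨ cong (_+ sum (map sum (blueLoop E₂ later m′))) (length-whites m es) ⟨
    length m′ + sum (map sum (blueLoop E₂ later m′))
      ≡⟨ blueLoop-sum later m′ ⟩
    length (marked later m′) ∎
    where
    open ≡-Reasoning
    es m′ : List (Subset n)
    es = revealed J later
    m′ = whites m es

  blueLoop-count : ∀ τ m →
    sum (map length (blueLoop E₂ τ m)) ≡ countᵇ (λ e → any (λ J → subB J e) τ) E₂
  blueLoop-count []          m = sym (countᵇ-false E₂)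
  blueLoop-count (J ∷ later) m rewrite markEdges≡considerEdges m (revealed J later) = begin
    length (duties m es) + sum (map length (blueLoop E₂ later (whites m es)))
      ≡⟨ cong₂ _+_ (trans (length-duties m es) (length-sortBy-filterᵇ σk _ E₂))
                   (blueLoop-count later (whites m es)) ⟩
    countᵇ (revealable J later) E₂ + countᵇ meetsLater E₂
      ≡⟨ cong (_+ countᵇ meetsLater E₂)
              (countᵇ-cong (λ e → cong (subB J e ∧_) (all-not≡not-any (λ J′ → subB J′ e) later)) E₂) ⟩
    countᵇ (λ e → subB J e ∧ not (meetsLater e)) E₂ + countᵇ meetsLater E₂
      ≡⟨ countᵇ-∧-not-+ (subB J) meetsLater E₂ ⟩
    countᵇ (λ e → any (λ J′ → subB J′ e) (J ∷ later)) E₂ ∎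
    where
    open ≡-Reasoning
    es : List (Subset n)
    es = revealed J later
    meetsLater : Subset n → Bool
    meetsLater e = any (λ J′ → subB J′ e) later

  blueLoop≤C : ∀ {j k} τ m → (∀ {J} → J ∈ 𝒥₀ → ∣ J ∣ ≡ j) → (∀ {e} → e ∈ E₂ → ∣ e ∣ ≡ k) →
               All (All (_≤ k C j)) (blueLoop E₂ τ m)
  blueLoop≤C []          m size₀ size₂ = []
  blueLoop≤C (J ∷ later) m size₀ size₂ rewrite markEdges≡considerEdges m (revealed J later) =
    duties≤C m (revealed J later) size₀
      (All.tabulate (size₂ ∘ proj₁ ∘ ∈-sortBy-filterᵇ⁻ σk _ E₂))
    ∷ blueLoop≤C later _ size₀ size₂

  ⊑-marked : ∀ τ m → m ⊑ marked τ m
  ⊑-marked []          m J∈m = J∈m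
  ⊑-marked (J ∷ later) m J∈m = ⊑-marked later _ (⊑-whites m (revealed J later) J∈m)

  marked-Unique-⊑ : ∀ τ m → Unique m → m ⊑ 𝒥₀ → Unique (marked τ m) × marked τ m ⊑ 𝒥₀
  marked-Unique-⊑ []          m !m m⊑ = !m , m⊑
  marked-Unique-⊑ (J ∷ later) m !m m⊑ =
    let (!m′ , m′⊑) = whites-Unique-⊑ m (revealed J later) !m m⊑ in marked-Unique-⊑ later _ !m′ m′⊑

  marked-cover : ∀ τ m {e J J′} → e ∈ E₂ → J ∈ τ → J ⊆ e → J′ ∈ 𝒥₀ → J′ ⊆ e → J′ ∈ marked τ m
  marked-cover (J₁ ∷ later) m {e} {J} e∈E₂ J∈τ J⊆e J′∈𝒥₀ J′⊆e with Any.any? (_⊆? e) later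
  ... | yes meets =
    let (J″ , J″∈later , J″⊆e) = find meets in
    marked-cover later _ e∈E₂ J″∈later J″⊆e J′∈𝒥₀ J′⊆e
  ... | no  none  = ⊑-marked later _ (whites-cover m (revealed J₁ later) e∈revealed J′∈𝒥₀ J′⊆e)
    where
    J₁⊆e : J₁ ⊆ e
    J₁⊆e = case J∈τ of λ where
      (here refl)     → J⊆e
      (there J∈later) → ⊥-elim (none (lose J∈later J⊆e))
    e∈revealed : e ∈ revealed J₁ later
    e∈revealed = ∈-sortBy-filterᵇ⁺ σk _ E₂ e∈E₂ (Equivalence.from T-∧ (subB-T J₁⊆e ,
      all⁻ _ (All.tabulate λ J′∈later → T-not⁺ λ t → none (lose J′∈later (T-subB t)))))

  module _ {J₀ : Subset n} (J₀∈𝒥₀ : J₀ ∈ 𝒥₀) (initial≡ : initial ≡ J₀ ∷ [])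
           {τ : List (Subset n)} (𝒥₀⊑τ : 𝒥₀ ⊑ τ) where

    blue-duty-total : Traversable 𝒥₀ E₂ → 1 + sum (map sum (blueLoop E₂ τ initial)) ≡ length 𝒥₀
    blue-duty-total traversable = begin
      1 + sum (map sum (blueLoop E₂ τ initial))
        ≡⟨ cong (λ w → length w + sum (map sum (blueLoop E₂ τ initial))) initial≡ ⟨
      length initial + sum (map sum (blueLoop E₂ τ initial))
        ≡⟨ blueLoop-sum τ initial ⟩
      length (marked τ initial)
        ≡⟨ Unique-⊑-antisym⇒length≡ (proj₁ marked-inv) !𝒥₀ (proj₂ marked-inv) 𝒥₀⊑marked ⟩
      length 𝒥₀ ∎
      where
      open ≡-Reasoning
      marked-inv : Unique (marked τ initial) × marked τ initial ⊑ 𝒥₀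
      marked-inv rewrite initial≡ = marked-Unique-⊑ τ (J₀ ∷ []) ([] ∷ []) λ { (here refl) → J₀∈𝒥₀ }
      J₀-marked : J₀ ∈ marked τ initial
      J₀-marked rewrite initial≡ = ⊑-marked τ (J₀ ∷ []) (here refl)
      𝒥₀⊑marked : 𝒥₀ ⊑ marked τ initial
      𝒥₀⊑marked J∈𝒥₀ with Traversable⇒edge-∋ traversable J₀∈𝒥₀ J∈𝒥₀
      ... | inj₁ refl               = J₀-marked
      ... | inj₂ (e , e∈E₂ , J⊆e) = marked-cover τ initial e∈E₂ (𝒥₀⊑τ J∈𝒥₀) J⊆e J∈𝒥₀ J⊆e

    blue-edge-count : (∀ {e} → e ∈ E₂ → ∃ λ J → J ∈ 𝒥₀ × J ⊆ e) →
                      sum (map length (blueLoop E₂ τ initial)) ≡ length E₂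
    blue-edge-count meets = trans (blueLoop-count τ initial)
      (countᵇ-all _ (All.tabulate λ e∈E₂ →
        let (J , J∈𝒥₀ , J⊆e) = meets e∈E₂ in any⁺ _ (lose (𝒥₀⊑τ J∈𝒥₀) (subB-T J⊆e))))

lemma2p4 : (n j k ℓ r b : ℕ) → 1 ≤ j → j < k → r < ℓ → b < ℓ →
    (σj σk : Subset n → ℕ) → TotalOrderOn j σj → TotalOrderOn k σk →
    (𝒥₀ E₁ E₂ : List (Subset n)) → InT j k ℓ r b 𝒥₀ E₁ E₂ →
    Inℳ ℓ r (proj₁ (blueprint j k ℓ σj σk 𝒥₀ E₁ E₂)) ×
    Inℳ ℓ b (proj₂ (blueprint j k ℓ σj σk 𝒥₀ E₁ E₂))
lemma2p4 n j k _ _ _ _ _ r<ℓ _ σj σk _ _ 𝒥₀ E₁ E₂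
  ((!𝒥₀ , size₀) , (!E₁ , size₁) , (_ , size₂) , refl , refl , refl ,
   (trav₁ , trav₂) , essential₁ , essential₂)
  with Colouring.initial-singleton σj σk 𝒥₀ !𝒥₀ (≤-<-trans z≤n r<ℓ)
... | J₀ , J₀∈𝒥₀ , initial≡ =
  ( (trans (fM-toMat R R-length R≤C) (cong (_∸ 1) (Red.red-duty-total J₀∈𝒥₀ initial≡ trav₁))
    , trans (gM-toMat R R-length R≤C) (Red.red-edge-count J₀∈𝒥₀ initial≡ trav₁ meets₁))
  , (trans (fM-toMat B B-length B≤C) (cong (_∸ 1) (Blue.blue-duty-total J₀∈𝒥₀ initial≡ 𝒥₀⊑τ trav₂))
    , trans (gM-toMat B B-length B≤C) (Blue.blue-edge-count J₀∈𝒥₀ initial≡ 𝒥₀⊑τ meets₂)) )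
  where
  module Red  = RedExploration σj σk 𝒥₀ !𝒥₀ E₁ !E₁
  module Blue = BlueMarking σj σk 𝒥₀ !𝒥₀ E₂
  open Explore σj σk 𝒥₀
  ℓ : ℕ
  ℓ = length 𝒥₀
  τ : List (Subset n)
  τ = proj₂ (red ℓ E₁)
  R B : List (List ℕ)
  R = proj₁ (red ℓ E₁)
  B = blue τ E₂
  𝒥₀⊑τ : 𝒥₀ ⊑ τ
  𝒥₀⊑τ = Red.𝒥₀⊑order J₀∈𝒥₀ initial≡ trav₁
  R-length : length R ≤ ℓ
  R-length = ≤-reflexive (Red.length-rows ℓ 0 initial [])
  B-length : length B ≤ ℓ
  B-length = ≤-reflexive (trans (Blue.length-blueLoop τ initial) (Red.length-order J₀∈𝒥₀ initial≡ trav₁))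
  R≤C : All (All (_≤ k C j)) R
  R≤C = Red.rows≤C ℓ 0 initial [] (All.lookup size₀) (All.lookup size₁)
  B≤C : All (All (_≤ k C j)) B
  B≤C = Blue.blueLoop≤C τ initial (All.lookup size₀) (All.lookup size₂)
  meets₁ : ∀ {e} → e ∈ E₁ → ∃ λ J → J ∈ 𝒥₀ × J ⊆ e
  meets₁ e∈E₁ = essential-edge-∋ trav₁ λ trav → essential₁ _ e∈E₁ (trav , trav₂)
  meets₂ : ∀ {e} → e ∈ E₂ → ∃ λ J → J ∈ 𝒥₀ × J ⊆ e
  meets₂ e∈E₂ = essential-edge-∋ trav₂ λ trav → essential₂ _ e∈E₂ (trav₁ , trav)
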